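{- Let $r\le n$ and $d\le r+1$ be positive integers and $0\le k\le n$ with $n-k+1=d-1$. Let $S=\{s_1,\dots,s_n\}\subseteq\mathbb{F}_2^r$ with $|S|=n$, $\mathrm{Span}(S)=\mathbb{F}_2^r$, and such that any $d-1$ vectors of $S$ are linearly independent. Let $\Gamma=\mathsf{Cay}(\mathbb{F}_2^r,S)$. Then the relative minimum distance of $\mathcal{C}[\Gamma,k]$ satisfies \[\Delta_H(\mathcal{C}[\Gamma,k])\geq 2^{d-r-2}\Big(1-\frac{k-1}{n}\Big).\]
   Context: $\mathbb{F}$ is a finite field with $|\mathbb{F}|>n$, $x_1,\dots,x_n\in\mathbb{F}$ pairwise distinct, $\mathsf{RS}[n,k]:=\{(p(x_1),\dots,p(x_n)):p\in\mathbb{F}[X],\deg p<k\}$. $\mathsf{Cay}(\mathbb{F}_2^r,S)$ is the $n$-regular indexed multigraph $(V,E)$ with $V=\mathbb{F}_2^r$ and $E(v,\ell)=v+s_\ell$ for $v\in V,\ell\in[n]$. The relation $\sim_E$ on $V\times[n]$: $(v,\ell)\sim_E(v',\ell')$ iff $\ell=\ell'$ and ($E(v,\ell)=v'$ or $v=v'$); $\overline{E}$ is the set of its classes. $W(\Gamma,\mathbb{F})$ is the set of $f:V\times[n]\to\mathbb{F}$ with $f(v,\ell)=f(v',\ell)$ whenever $(v,\ell)\sim_E(v',\ell)$. $\mathcal{C}[\Gamma,k]:=\{f\in W(\Gamma,\mathbb{F}):\forall v\in V, (f(v,1),\dots,f(v,n))\in\mathsf{RS}[n,k]\}$. The relative Hamming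 weight of $f$ is $\frac{1}{|\overline{E}|}|\{\overline{(v,\ell)}\in\overline{E}: f(v,\ell)\neq0\}|$, and $\Delta_H(\mathcal{C}[\Gamma,k])$ is the minimum relative Hamming weight of a nonzero element of $\mathcal{C}[\Gamma,k]$. -}

module Defs where

open import Level using (Level; _⊔_) renaming (suc to lsuc)
open import Algebra.Bundles using (CommutativeRing)
open import Data.Bool using (Bool; true; false; _xor_)
open import Data.Nat using (ℕ; zero; suc)
open import Data.Fin using (Fin)
open import Data.Fin.Subset using (Subset; inside; outside)
open import Data.Vec using (Vec; []; _∷_; zipWith; replicate; lookup)
open import Data.List using (List; []; _∷_; map; _++_; cartesianProduct; allFin; length)
open import Data.List.Membership.Setoid using () renaming (_∈_ to _∈ₛ_)
open import Data.Product using (Σ; _×_; _,_; proj₁; proj₂; ∃)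
open import Data.Sum using (_⊎_)
open import Function.Definitions using (Injective)
open import Relation.Nullary using (¬_; Dec; yes; no)
open import Relation.Binary using (Decidable)
open import Relation.Binary.PropositionalEquality using (_≡_)

record FiniteField (c ℓ : Level) : Set (lsuc (c ⊔ ℓ)) where
  field
    commRing  : CommutativeRing c ℓ
  open CommutativeRing commRing public
  field
    1≉0       : ¬ (1# ≈ 0#)
    inverse   : ∀ x → ¬ (x ≈ 0#) → Σ Carrier (λ y → (x * y) ≈ 1#)
    _≟_       : Decidable _≈_
    elements  : List Carrier
    complete  : ∀ x → _∈ₛ_ setoid x elements

module RSCode {c ℓ} (F : FiniteField c ℓ) where
  open FiniteField F

  pow : Carrier → ℕ → Carrier
  pow x zero    = 1#
  pow x (suc j) = x * pow x j

  sumF : (k : ℕ) → (Fin k → Carrier) → Carrier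
  sumF zero    g = 0#
  sumF (suc k) g = g Data.Fin.zero + sumF k (λ j → g (Data.Fin.suc j))

  evalPoly : (k : ℕ) → (Fin k → Carrier) → Carrier → Carrier
  evalPoly k coeffs x = sumF k (λ j → coeffs j * pow x (Data.Fin.toℕ j))

  InRS : (n k : ℕ) → (xs : Fin n → Carrier) → (Fin n → Carrier) → Set (c ⊔ ℓ)
  InRS n k xs w = Σ (Fin k → Carrier) λ coeffs → ∀ i → w i ≈ evalPoly k coeffs (xs i)

F2^ : ℕ → Set
F2^ r = Vec Bool r

_⊕_ : ∀ {r} → F2^ r → F2^ r → F2^ r
_⊕_ = zipWith _xor_

𝟎 : ∀ {r} → F2^ r
𝟎 = replicate _ false

allVecs : (r : ℕ) → List (F2^ r)
allVecs zero    = [] ∷ []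
allVecs (suc r) = map (false ∷_) (allVecs r) ++ map (true ∷_) (allVecs r)

_≟V_ : ∀ {r} → Decidable {A = F2^ r} _≡_
_≟V_ = Data.Vec.Properties.≡-dec Data.Bool._≟_
  where import Data.Vec.Properties; import Data.Bool

subsetSum : ∀ {r n} → (Fin n → F2^ r) → Subset n → F2^ r
subsetSum {n = zero}  s []            = 𝟎
subsetSum {n = suc n} s (inside ∷ U)  = s Data.Fin.zero ⊕ subsetSum (λ i → s (Data.Fin.suc i)) U
subsetSum {n = suc n} s (outside ∷ U) = subsetSum (λ i → s (Data.Fin.suc i)) U

Spans : ∀ {r n} → (Fin n → F2^ r) → Set
Spans {r} s = ∀ (v : F2^ r) → ∃ λ U → subsetSum s U ≡ v

LinIndepOn : ∀ {r n} → (Fin n → F2^ r) → Subset n → Set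
LinIndepOn s T = ∀ U → U Data.Fin.Subset.⊆ T → subsetSum s U ≡ 𝟎 → U ≡ Data.Fin.Subset.⊥

AnyLinIndep : ∀ {r n} → ℕ → (Fin n → F2^ r) → Set
AnyLinIndep m s = ∀ T → Data.Fin.Subset.∣ T ∣ ≡ m → LinIndepOn s T

-- Counting equivalence classes of a decidable equivalence relation on a
-- finite set enumerated (without repetition) by a list: a class is
-- counted once, at its first occurrence in the list.  `countClasses P`
-- counts those classes whose first representative satisfies P.

module _ {a p q} {A : Set a} (R : A → A → Set q) (R? : ∀ x y → Dec (R x y))
         (P : A → Set p) (P? : ∀ x → Dec (P x)) where

  relatedToSome : A → List A → Bool
  relatedToSome x []       = false
  relatedToSome x (y ∷ ys) with R? y x
  ... | yes _ = true
  ... | no  _ = relatedToSome x ys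

  countClassesFrom : List A → List A → ℕ
  countClassesFrom seen []       = 0
  countClassesFrom seen (x ∷ xs) with relatedToSome x seen | P? x
  ... | false | yes _ = suc (countClassesFrom (x ∷ seen) xs)
  ... | _     | _     = countClassesFrom (x ∷ seen) xs

  countClasses : List A → ℕ
  countClasses = countClassesFrom []

module Cayley {r n : ℕ} (s : Fin n → F2^ r) where

  E : F2^ r → Fin n → F2^ r
  E v ℓ = v ⊕ s ℓ

  _∼E_ : (F2^ r × Fin n) → (F2^ r × Fin n) → Set
  (v , ℓ) ∼E (v' , ℓ') = ℓ ≡ ℓ' × (E v ℓ ≡ v' ⊎ v ≡ v')

  ∼E? : ∀ x y → Dec (x ∼E y)
  ∼E? (v , ℓ) (v' , ℓ') with ℓ Data.Fin.≟ ℓ' | E v ℓ ≟V v' | v ≟V v'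
  ... | no ¬p | _ | _ = no λ { (p , _) → ¬p p }
  ... | yes p | yes q | _ = yes (p , Data.Sum.inj₁ q)
  ... | yes p | no _ | yes q = yes (p , Data.Sum.inj₂ q)
  ... | yes p | no ¬q | no ¬q' = no λ { (_ , Data.Sum.inj₁ q) → ¬q q ; (_ , Data.Sum.inj₂ q) → ¬q' q }

  allPairs : List (F2^ r × Fin n)
  allPairs = cartesianProduct (allVecs r) (allFin n)

  module _ {c ℓ} (F : FiniteField c ℓ) where
    open FiniteField F
    open RSCode F

    InW : (F2^ r → Fin n → Carrier) → Set ℓ
    InW f = ∀ v ℓ' v' → (v , ℓ') ∼E (v' , ℓ') → f v ℓ' ≈ f v' ℓ'

    InCode : (k : ℕ) → (xs : Fin n → Carrier) → (F2^ r → Fin n → Carrier) → Set (c ⊔ ℓ)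
    InCode k xs f = InW f × (∀ v → InRS n k xs (f v))

    NonZero : (F2^ r → Fin n → Carrier) → Set ℓ
    NonZero f = Σ (F2^ r) λ v → Σ (Fin n) λ ℓ' → ¬ (f v ℓ' ≈ 0#)

    numEdges : ℕ
    numEdges = countClasses _∼E_ ∼E? (λ _ → Data.Unit.⊤) (λ _ → yes Data.Unit.tt) allPairs
      where import Data.Unit

    weight : (F2^ r → Fin n → Carrier) → ℕ
    weight f = countClasses _∼E_ ∼E? (λ { (v , ℓ') → ¬ (f v ℓ' ≈ 0#) })
                 (λ { (v , ℓ') → Relation.Nullary.¬? (f v ℓ' ≟ 0#) }) allPairs
      where import Relation.Nullary

-- A nonzero row of a codeword f (its values on the half-edges at one vertex) is a nonzero
-- Reed–Solomon codeword, so it has at least m = n − k + 1 = d − 1 nonzero entries; and as f is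
-- constant on edges, a nonzero entry in direction g at v makes the row at v + s_g nonzero too.
-- Exploring from a nonzero row, each step picks a fresh nonzero direction and either forbids it
-- or follows it.  After m steps the leaves are sums over at least 2^(m−1) distinct sets U of at
-- most ⌊m/2⌋ generators; since any m generators are independent, distinct U give distinct
-- vertices.  So there are at least m·2^(m−1) nonzero half-edges.  The two half-edges (v, g) and
-- (v + s_g, g) of an edge carry the same value, so the weight and |Ē| = 2^r·n/2 are half the
-- corresponding half-edge counts, and the bound follows.

module Submission where

open import Defs
open import Level using (Level; 0ℓ; _⊔_; Lift; lift)
open import Algebra.Bundles using (CommutativeRing; AbelianGroup)
open import Algebra.Structures using (IsAbelianGroup)
open import Data.Bool using (Bool; true; false; not; _xor_)
open import Data.Bool.Properties using (xor-assoc; xor-comm; xor-identityˡ; xor-identityʳ; xor-same)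
open import Data.Fin using (Fin) renaming (zero to fz; suc to fs)
import Data.Fin as Fin
import Data.Fin.Properties as Finₚ
open import Data.Maybe using (nothing)
open import Data.Nat using (ℕ; zero; suc)
open import Data.Product using (_×_; _,_; proj₁; proj₂; ∃; ∃₂)
import Data.Product.Properties as Product
open import Data.Sum using (_⊎_; inj₁; inj₂)
import Data.Sum as Sum
open import Data.Empty using (⊥-elim)
open import Data.Unit using (tt)
open import Function using (_∘_; id; _⇔_; mk⇔; Equivalence)
open import Function.Definitions using (Injective)
open import Relation.Binary using (DecidableEquality)
open import Relation.Binary.PropositionalEquality using (_≡_; _≢_)
open import Relation.Nullary using (¬_; Dec; yes; no; does; ¬?; contradiction; _×-dec_)
open import Relation.Nullary.Decidable using (_→-dec_)
open import Relation.Unary using (Pred; Decidable)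

-- Polynomials

module FactorIdentity {c ℓ} (R : CommutativeRing c ℓ) where
  open import Tactic.RingSolver using (solve-∀)
  open import Tactic.RingSolver.Core.AlmostCommutativeRing using (AlmostCommutativeRing; fromCommutativeRing)
  private
    solverRing : AlmostCommutativeRing c ℓ
    solverRing = fromCommutativeRing R (λ _ → nothing)
  open AlmostCommutativeRing solverRing

  factor-step : ∀ x a c₀ h k q → (c₀ + x * h) + a * (k + x * q) ≈ (c₀ + a * k) + x * (h + a * q)
  factor-step = solve-∀ solverRing

module Polynomials {c ℓ} (R : CommutativeRing c ℓ) where
  open CommutativeRing R
  open FactorIdentity R
  open import Relation.Binary.Reasoning.Setoid setoid

  -- g agrees everywhere with a polynomial function of degree < k, in Horner form a + x · h x
  DegreeBelow : ℕ → (Carrier → Carrier) → Set (c ⊔ ℓ)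
  DegreeBelow zero    g = Lift c (∀ x → g x ≈ 0#)
  DegreeBelow (suc k) g = ∃₂ λ a h → DegreeBelow k h × (∀ x → g x ≈ a + x * h x)

  -- g x − g a = (x − a) · q x, written without subtraction
  factor-theorem : ∀ k g → DegreeBelow (suc k) g → ∀ a →
                   ∃ λ q → DegreeBelow k q × (∀ x → g x + a * q x ≈ g a + x * q x)
  factor-theorem zero g (c₀ , h , lift h≈0 , g≈) a = (λ _ → 0#) , lift (λ _ → refl) , λ x → begin
    g x + a * 0#            ≈⟨ +-cong (g≈ x) (zeroʳ a) ⟩
    (c₀ + x * h x) + 0#     ≈⟨ +-cong (+-congˡ (trans (*-congˡ (h≈0 x)) (zeroʳ x))) (sym (zeroʳ x)) ⟩
    (c₀ + 0#) + x * 0#      ≈⟨ +-congʳ (+-congˡ (sym (trans (*-congˡ (h≈0 a)) (zeroʳ a)))) ⟩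
    (c₀ + a * h a) + x * 0# ≈⟨ +-congʳ (sym (g≈ a)) ⟩
    g a + x * 0#            ∎
  factor-theorem (suc k) g (c₀ , h , h-deg , g≈) a =
    let q , q-deg , h≈ = factor-theorem k h h-deg a in
    (λ x → h a + x * q x) , (h a , q , q-deg , λ _ → refl) , λ x → begin
      g x + a * (h a + x * q x)                ≈⟨ +-congʳ (g≈ x) ⟩
      (c₀ + x * h x) + a * (h a + x * q x)     ≈⟨ factor-step x a c₀ (h x) (h a) (q x) ⟩
      (c₀ + a * h a) + x * (h x + a * q x)     ≈⟨ +-cong (sym (g≈ a)) (*-congˡ (h≈ x)) ⟩
      g a + x * (h a + x * q x)                ∎

module _ {c ℓ} (F : FiniteField c ℓ) where
  open FiniteField F
  open RSCode F
  open Polynomials commRing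
  open import Relation.Binary.Reasoning.Setoid setoid
  open import Algebra.Properties.Ring ring using (x∙y⁻¹≈ε⇒x≈y; -‿distribˡ-*)
  open import Algebra.Properties.CommutativeSemigroup *-commutativeSemigroup using (x∙yz≈y∙xz)

  sumF-cong : ∀ k {g g′ : Fin k → Carrier} → (∀ j → g j ≈ g′ j) → sumF k g ≈ sumF k g′
  sumF-cong zero    g≈g′ = refl
  sumF-cong (suc k) g≈g′ = +-cong (g≈g′ fz) (sumF-cong k (λ j → g≈g′ (fs j)))

  sumF-distribˡ : ∀ k a (g : Fin k → Carrier) → sumF k (λ j → a * g j) ≈ a * sumF k g
  sumF-distribˡ zero    a g = sym (zeroʳ a)
  sumF-distribˡ (suc k) a g = trans (+-congˡ (sumF-distribˡ k a (λ j → g (fs j)))) (sym (distribˡ a _ _))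

  evalPoly-degreeBelow : ∀ k cs → DegreeBelow k (evalPoly k cs)
  evalPoly-degreeBelow zero    cs = lift (λ _ → refl)
  evalPoly-degreeBelow (suc k) cs =
    cs fz , evalPoly k (λ j → cs (fs j)) , evalPoly-degreeBelow k (λ j → cs (fs j)) , λ x →
      +-cong (*-identityʳ (cs fz))
             (trans (sumF-cong k (λ j → x∙yz≈y∙xz (cs (fs j)) x _)) (sumF-distribˡ k x _))

  x≉0∧x*y≈0⇒y≈0 : ∀ {x y} → ¬ (x ≈ 0#) → x * y ≈ 0# → y ≈ 0#
  x≉0∧x*y≈0⇒y≈0 {x} {y} x≉0 xy≈0 = let x⁻¹ , xx⁻¹≈1 = inverse x x≉0 in begin
    y              ≈⟨ sym (*-identityˡ y) ⟩
    1# * y         ≈⟨ *-congʳ (trans (sym xx⁻¹≈1) (*-comm x x⁻¹)) ⟩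
    (x⁻¹ * x) * y  ≈⟨ *-assoc x⁻¹ x y ⟩
    x⁻¹ * (x * y)  ≈⟨ *-congˡ xy≈0 ⟩
    x⁻¹ * 0#       ≈⟨ zeroʳ x⁻¹ ⟩
    0#             ∎

  *-cancelʳ-≉ : ∀ {a b} v → ¬ (a ≈ b) → a * v ≈ b * v → v ≈ 0#
  *-cancelʳ-≉ {a} {b} v a≉b av≈bv = x≉0∧x*y≈0⇒y≈0 (λ a-b≈0 → a≉b (x∙y⁻¹≈ε⇒x≈y a b a-b≈0)) (begin
    (a - b) * v        ≈⟨ distribʳ v a (- b) ⟩
    a * v + - b * v    ≈⟨ +-cong av≈bv (sym (-‿distribˡ-* b v)) ⟩
    b * v + - (b * v)  ≈⟨ -‿inverseʳ (b * v) ⟩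
    0#                 ∎)

  degreeBelow-vanishes : ∀ k g → DegreeBelow k g → (as : Fin k → Carrier) → Injective _≡_ _≈_ as →
                         (∀ i → g (as i) ≈ 0#) → ∀ x → g x ≈ 0#
  degreeBelow-vanishes zero    g (lift g≈0) as as-inj roots x = g≈0 x
  degreeBelow-vanishes (suc k) g g-deg      as as-inj roots x = begin
    g x               ≈⟨ sym (+-identityʳ (g x)) ⟩
    g x + 0#          ≈⟨ +-congˡ (sym (trans (*-congˡ (q≈0 x)) (zeroʳ a))) ⟩
    g x + a * q x     ≈⟨ g≈ x ⟩
    g a + x * q x     ≈⟨ +-cong (roots fz) (trans (*-congˡ (q≈0 x)) (zeroʳ x)) ⟩
    0# + 0#           ≈⟨ +-identityʳ 0# ⟩
    0#                ∎
    where
    a = as fz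
    factored = factor-theorem k g g-deg a
    q = proj₁ factored
    g≈ = proj₂ (proj₂ factored)
    q-root : ∀ i → q (as (fs i)) ≈ 0#
    q-root i = *-cancelʳ-≉ (q b) (λ a≈b → Finₚ.0≢1+n (as-inj a≈b)) (begin
        a * q b          ≈⟨ sym (+-identityˡ _) ⟩
        0# + a * q b     ≈⟨ +-congʳ (sym (roots (fs i))) ⟩
        g b + a * q b    ≈⟨ g≈ b ⟩
        g a + b * q b    ≈⟨ +-congʳ (roots fz) ⟩
        0# + b * q b     ≈⟨ +-identityˡ _ ⟩
        b * q b          ∎)
      where b = as (fs i)
    q≈0 : ∀ y → q y ≈ 0#
    q≈0 = degreeBelow-vanishes k q (proj₁ (proj₂ factored)) (λ i → as (fs i))
            (λ e → Finₚ.suc-injective (as-inj e)) q-root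

-- Arithmetic on ℕ is opened only from here on: its names clash with the ring operations above.
open import Data.Nat using (ℕ; zero; suc; _+_; _*_; _∸_; _^_; _≤_; _<_; z≤n; s≤s; _≤?_; ⌊_/2⌋; ⌈_/2⌉)
open import Data.Nat.Properties hiding (_≟_)
open import Algebra.Properties.CommutativeSemigroup *-commutativeSemigroup using (x∙yz≈y∙xz)
open import Data.Nat.Tactic.RingSolver using (solve-∀)
open import Relation.Binary.PropositionalEquality hiding ([_])
open import Data.List using (List; []; _∷_; _++_; map; length; filter; [_]; cartesianProduct; allFin; tabulate)
open import Data.List.Properties
  using ( length-++; length-map; length-tabulate; map-tabulate
        ; filter-++; filter-all; filter-none; filter-accept; filter-reject)
open import Data.List.Relation.Unary.All as All using (All; []; _∷_)
import Data.List.Relation.Unary.All.Properties as All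
open import Data.List.Relation.Unary.Any using (here; there)
open import Data.List.Relation.Unary.AllPairs using ([]; _∷_)
open import Data.List.Relation.Unary.Unique.Propositional using (Unique)
import Data.List.Relation.Unary.Unique.Propositional.Properties as Unique
open import Data.List.Membership.Propositional.Properties
  using (∈-∃++; ∈-++⁺ˡ; ∈-++⁺ʳ; ∈-++⁻; ∈-map⁺; ∈-map⁻; ∈-cartesianProduct⁺; ∈-allFin)
open import Data.List.Relation.Binary.Permutation.Propositional.Properties using (↭-length; filter-↭; shift)

-- Counting

module Counting {a} {A : Set a} where
  open import Data.List.Membership.Propositional using (_∈_)

  count : ∀ {p} {P : Pred A p} → Decidable P → List A → ℕ
  count P? = length ∘ filter P?

  module _ {p} {P : Pred A p} (P? : Decidable P) where

    count-++ : ∀ xs ys → count P? (xs ++ ys) ≡ count P? xs + count P? ys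
    count-++ xs ys = trans (cong length (filter-++ P? xs ys)) (length-++ (filter P? xs))

    count-all : ∀ {xs} → All P xs → count P? xs ≡ length xs
    count-all = cong length ∘ filter-all P?

    count-none : ∀ {xs} → All (¬_ ∘ P) xs → count P? xs ≡ 0
    count-none = cong length ∘ filter-none P?

    count-accept : ∀ {x xs} → P x → count P? (x ∷ xs) ≡ suc (count P? xs)
    count-accept = cong length ∘ filter-accept P?

    count-reject : ∀ {x xs} → ¬ P x → count P? (x ∷ xs) ≡ count P? xs
    count-reject = cong length ∘ filter-reject P?

    count-∷-mono : ∀ x {xs ys} → count P? xs ≤ count P? ys → count P? (x ∷ xs) ≤ count P? (x ∷ ys)
    count-∷-mono x xs≤ys with P? x
    ... | yes _ = s≤s xs≤ys
    ... | no  _ = xs≤ys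

    count-mono-⊆ : ∀ {xs ys} → Unique xs → (∀ {y} → y ∈ xs → y ∈ ys) → count P? xs ≤ count P? ys
    count-mono-⊆ {[]}     _              _     = z≤n
    count-mono-⊆ {x ∷ xs} (x≢xs ∷ xs-uniq) xs⊆ys with ∈-∃++ (xs⊆ys (here refl))
    ... | L₁ , L₂ , refl = begin
      count P? (x ∷ xs)            ≤⟨ count-∷-mono x (count-mono-⊆ xs-uniq xs⊆L₁++L₂) ⟩
      count P? (x ∷ L₁ ++ L₂)      ≡⟨ sym (↭-length (filter-↭ P? (shift x L₁ L₂))) ⟩
      count P? (L₁ ++ [ x ] ++ L₂) ∎
      where
      open ≤-Reasoning
      xs⊆L₁++L₂ : ∀ {y} → y ∈ xs → y ∈ L₁ ++ L₂
      xs⊆L₁++L₂ {y} y∈xs with ∈-++⁻ L₁ (xs⊆ys (there y∈xs))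
      ... | inj₁ y∈L₁          = ∈-++⁺ˡ y∈L₁
      ... | inj₂ (here refl)   = contradiction refl (All.lookup x≢xs y∈xs)
      ... | inj₂ (there y∈L₂)  = ∈-++⁺ʳ L₁ y∈L₂

  module _ {p q} {P : Pred A p} {Q : Pred A q} (P? : Decidable P) (Q? : Decidable Q) where

    count-cong-∈ : ∀ xs → (∀ {y} → y ∈ xs → P y ⇔ Q y) → count P? xs ≡ count Q? xs
    count-cong-∈ []       _   = refl
    count-cong-∈ (x ∷ xs) P⇔Q with P? x | Q? x
    ... | yes _  | yes _  = cong suc (count-cong-∈ xs (P⇔Q ∘ there))
    ... | no  _  | no  _  = count-cong-∈ xs (P⇔Q ∘ there)
    ... | yes Px | no ¬Qx = contradiction (Equivalence.to (P⇔Q (here refl)) Px) ¬Qx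
    ... | no ¬Px | yes Qx = contradiction (Equivalence.from (P⇔Q (here refl)) Qx) ¬Px

    count-insert : ∀ {z} xs → Unique xs → z ∈ xs → ¬ P z → (∀ {y} → y ∈ xs → Q y ⇔ (P y ⊎ y ≡ z)) →
                   count Q? xs ≡ suc (count P? xs)
    count-insert (x ∷ xs) (x≢xs ∷ xs-uniq) (here refl) ¬Pz Q⇔ with P? x | Q? x
    ... | yes Px | _      = contradiction Px ¬Pz
    ... | no  _  | no ¬Qx = contradiction (Equivalence.from (Q⇔ (here refl)) (inj₂ refl)) ¬Qx
    ... | no  _  | yes _  = cong suc (sym (count-cong-∈ xs P⇔Q))
      where
      P⇔Q : ∀ {y} → y ∈ xs → P y ⇔ Q y
      P⇔Q y∈xs = mk⇔ (Equivalence.from (Q⇔ (there y∈xs)) ∘ inj₁)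
        (Sum.[ id , (λ y≡x → contradiction (sym y≡x) (All.lookup x≢xs y∈xs)) ] ∘ Equivalence.to (Q⇔ (there y∈xs)))
    count-insert (x ∷ xs) (x≢xs ∷ xs-uniq) (there z∈xs) ¬Pz Q⇔ with P? x | Q? x
    ... | yes _  | yes _  = cong suc (count-insert xs xs-uniq z∈xs ¬Pz (Q⇔ ∘ there))
    ... | no  _  | no  _  = count-insert xs xs-uniq z∈xs ¬Pz (Q⇔ ∘ there)
    ... | yes Px | no ¬Qx = contradiction (Equivalence.from (Q⇔ (here refl)) (inj₁ Px)) ¬Qx
    ... | no ¬Px | yes Qx = ⊥-elim (Sum.[ ¬Px , All.lookup x≢xs z∈xs ] (Equivalence.to (Q⇔ (here refl)) Qx))

open Counting

module InvolutionClasses {a p q} {A : Set a} (_≟_ : DecidableEquality A)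
  (π : A → A) (π-involutive : ∀ x → π (π x) ≡ x) (π-fixpointFree : ∀ x → π x ≢ x)
  {R : A → A → Set q} (R? : ∀ x y → Dec (R x y)) (R⇔ : ∀ {y x} → R y x ⇔ (x ≡ y ⊎ π x ≡ y))
  {P : Pred A p} (P? : Decidable P) (P-π : ∀ {x} → P x → P (π x)) where

  open import Data.List.Membership.Propositional using (_∈_; _∉_)
  open import Data.List.Membership.DecPropositional _≟_ using (_∈?_)
  open ≡-Reasoning

  private
    classesFrom : List A → List A → ℕ
    classesFrom = countClassesFrom R R? P P?

    disjoint-∷ : ∀ {x : A} {seen xs} → All (x ≢_) xs → (∀ {y} → y ∈ x ∷ xs → y ∉ seen) → ∀ {y} → y ∈ xs → y ∉ x ∷ seen
    disjoint-∷ x≢xs disjoint y∈xs (here y≡x)     = All.lookup x≢xs y∈xs (sym y≡x)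
    disjoint-∷ x≢xs disjoint y∈xs (there y∈seen) = disjoint (there y∈xs) y∈seen

    closed-∷ : ∀ {x : A} {seen xs} → (∀ {y} → y ∈ x ∷ xs → π y ∈ seen ⊎ π y ∈ x ∷ xs) →
               ∀ {y} → y ∈ xs → π y ∈ x ∷ seen ⊎ π y ∈ xs
    closed-∷ closed y∈xs with closed (there y∈xs)
    ... | inj₁ πy∈seen         = inj₁ (there πy∈seen)
    ... | inj₂ (here πy≡x)     = inj₁ (here πy≡x)
    ... | inj₂ (there πy∈xs)   = inj₂ πy∈xs

    classesFrom-related : ∀ {x} seen xs → relatedToSome R R? P P? x seen ≡ true →
                          classesFrom seen (x ∷ xs) ≡ classesFrom (x ∷ seen) xs
    classesFrom-related {x} seen xs rel with relatedToSome R R? P P? x seen | P? x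
    ... | true | yes _ = refl
    ... | true | no  _ = refl
    classesFrom-related seen xs () | false | _

    classesFrom-fresh : ∀ {x} seen xs → relatedToSome R R? P P? x seen ≡ false → P x →
                        classesFrom seen (x ∷ xs) ≡ suc (classesFrom (x ∷ seen) xs)
    classesFrom-fresh {x} seen xs rel Px with relatedToSome R R? P P? x seen | P? x
    classesFrom-fresh seen xs () Px | true | _
    ... | false | yes _  = refl
    ... | false | no ¬Px = contradiction Px ¬Px

    classesFrom-reject : ∀ {x} seen xs → ¬ P x → classesFrom seen (x ∷ xs) ≡ classesFrom (x ∷ seen) xs
    classesFrom-reject {x} seen xs ¬Px with relatedToSome R R? P P? x seen | P? x
    ... | true  | _      = refl
    ... | false | yes Px = contradiction Px ¬Px
    ... | false | no  _  = refl

    relatedToSome-true : ∀ {x} seen → x ∉ seen → relatedToSome R R? P P? x seen ≡ true → π x ∈ seen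
    relatedToSome-true {x} (y ∷ ys) x∉y∷ys rel with R? y x
    ... | yes Ryx = Sum.[_,_]′ (λ x≡y → contradiction (here x≡y) x∉y∷ys) here (Equivalence.to R⇔ Ryx)
    ... | no  _   = there (relatedToSome-true ys (x∉y∷ys ∘ there) rel)

    relatedToSome-false : ∀ {x} seen → relatedToSome R R? P P? x seen ≡ false → π x ∉ seen
    relatedToSome-false {x} (y ∷ ys) rel πx∈ with R? y x
    relatedToSome-false {x} (y ∷ ys) () πx∈          | yes _
    relatedToSome-false {x} (y ∷ ys) rel (here πx≡y)  | no ¬Ryx = ¬Ryx (Equivalence.from R⇔ (inj₂ πx≡y))
    relatedToSome-false {x} (y ∷ ys) rel (there πx∈ys) | no _   = relatedToSome-false ys rel πx∈ys

    P-π⁻¹ : ∀ {x} → P (π x) → P x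
    P-π⁻¹ {x} = subst P (π-involutive x) ∘ P-π

  -- second halves of P-classes: each class is counted at its first half, when its partner is unseen
  Paired : List A → Pred A _
  Paired seen y = P y × π y ∈ seen

  Paired? : ∀ seen → Decidable (Paired seen)
  Paired? seen y = P? y ×-dec (π y ∈? seen)

  private
    count-Paired-∷ : ∀ {x} seen xs → ¬ (π x ∈ xs × P (π x)) →
                     count (Paired? (x ∷ seen)) xs ≡ count (Paired? seen) xs
    count-Paired-∷ {x} seen xs ¬πx∈xs = count-cong-∈ (Paired? (x ∷ seen)) (Paired? seen) xs λ {y} y∈xs →
      mk⇔ (λ { (Py , here πy≡x) → contradiction (πy≡x⇒ y∈xs Py πy≡x) ¬πx∈xs ; (Py , there πy∈) → Py , πy∈ })
          (λ (Py , πy∈) → Py , there πy∈)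
      where
      πy≡x⇒ : ∀ {y} → y ∈ xs → P y → π y ≡ x → π x ∈ xs × P (π x)
      πy≡x⇒ {y} y∈xs Py πy≡x = subst (_∈ xs) y≡πx y∈xs , subst P y≡πx Py
        where y≡πx = trans (sym (π-involutive y)) (cong π πy≡x)

    count-Paired-∷-suc : ∀ {x} seen xs → Unique xs → x ∉ seen → π x ∈ xs → P (π x) →
                         count (Paired? (x ∷ seen)) xs ≡ suc (count (Paired? seen) xs)
    count-Paired-∷-suc {x} seen xs xs-uniq x∉seen πx∈xs Pπx =
      count-insert (Paired? seen) (Paired? (x ∷ seen)) xs xs-uniq πx∈xs
        (λ (_ , ππx∈seen) → x∉seen (subst (_∈ seen) (π-involutive x) ππx∈seen))
        λ {y} y∈xs → mk⇔
          (λ { (Py , here πy≡x) → inj₂ (trans (sym (π-involutive y)) (cong π πy≡x))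
             ; (Py , there πy∈) → inj₁ (Py , πy∈) })
          (λ { (inj₁ (Py , πy∈)) → Py , there πy∈ ; (inj₂ refl) → Pπx , here (π-involutive x) })

  countClassesFrom-invariant : ∀ seen xs → Unique xs → (∀ {y} → y ∈ xs → y ∉ seen) →
    (∀ {y} → y ∈ xs → π y ∈ seen ⊎ π y ∈ xs) →
    2 * countClassesFrom R R? P P? seen xs + count (Paired? seen) xs ≡ count P? xs
  countClassesFrom-invariant seen []       _ _ _ = refl
  countClassesFrom-invariant seen (x ∷ xs) (x≢xs ∷ xs-uniq) disjoint closed =
    by-cases (relatedToSome R R? P P? x seen) refl (P? x)
    where
    C = classesFrom (x ∷ seen) xs
    Q = count (Paired? seen) xs
    Q′ = count (Paired? (x ∷ seen)) xs
    IH : 2 * C + Q′ ≡ count P? xs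
    IH = countClassesFrom-invariant (x ∷ seen) xs xs-uniq (disjoint-∷ x≢xs disjoint) (closed-∷ closed)
    x∉seen = disjoint (here refl)
    by-cases : ∀ b → relatedToSome R R? P P? x seen ≡ b → Dec (P x) →
               2 * classesFrom seen (x ∷ xs) + count (Paired? seen) (x ∷ xs) ≡ count P? (x ∷ xs)
    by-cases _ _ (no ¬Px) = begin
      2 * classesFrom seen (x ∷ xs) + count (Paired? seen) (x ∷ xs)
        ≡⟨ cong₂ (λ c q → 2 * c + q) (classesFrom-reject seen xs ¬Px) (count-reject (Paired? seen) (¬Px ∘ proj₁)) ⟩
      2 * C + Q   ≡⟨ cong (2 * C +_) (sym (count-Paired-∷ seen xs (¬Px ∘ P-π⁻¹ ∘ proj₂))) ⟩
      2 * C + Q′  ≡⟨ IH ⟩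
      count P? xs ≡⟨ sym (count-reject P? ¬Px) ⟩
      count P? (x ∷ xs) ∎
    by-cases true rel (yes Px) = begin
      2 * classesFrom seen (x ∷ xs) + count (Paired? seen) (x ∷ xs)
        ≡⟨ cong₂ (λ c q → 2 * c + q) (classesFrom-related seen xs rel) (count-accept (Paired? seen) (Px , πx∈seen)) ⟩
      2 * C + suc Q   ≡⟨ cong (λ q → 2 * C + suc q) (sym (count-Paired-∷ seen xs πx∉xs)) ⟩
      2 * C + suc Q′  ≡⟨ +-suc (2 * C) Q′ ⟩
      suc (2 * C + Q′) ≡⟨ cong suc IH ⟩
      suc (count P? xs) ≡⟨ sym (count-accept P? Px) ⟩
      count P? (x ∷ xs) ∎
      where
      πx∈seen = relatedToSome-true seen x∉seen rel
      πx∉xs = λ (πx∈xs , _) → disjoint (there πx∈xs) πx∈seen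
    by-cases false rel (yes Px) = begin
      2 * classesFrom seen (x ∷ xs) + count (Paired? seen) (x ∷ xs)
        ≡⟨ cong₂ (λ c q → 2 * c + q) (classesFrom-fresh seen xs rel Px) (count-reject (Paired? seen) (πx∉seen ∘ proj₂)) ⟩
      2 * suc C + Q     ≡⟨ cong (_+ Q) (*-suc 2 C) ⟩
      2 + 2 * C + Q     ≡⟨ cong suc (sym (+-suc (2 * C) Q)) ⟩
      suc (2 * C + suc Q)
        ≡⟨ cong (λ q → suc (2 * C + q)) (sym (count-Paired-∷-suc seen xs xs-uniq x∉seen πx∈xs (P-π Px))) ⟩
      suc (2 * C + Q′)  ≡⟨ cong suc IH ⟩
      suc (count P? xs) ≡⟨ sym (count-accept P? Px) ⟩
      count P? (x ∷ xs) ∎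
      where
      πx∉seen = relatedToSome-false seen rel
      πx∈xs : π x ∈ xs
      πx∈xs with closed (here refl)
      ... | inj₁ πx∈seen       = contradiction πx∈seen πx∉seen
      ... | inj₂ (here πx≡x)   = contradiction πx≡x (π-fixpointFree x)
      ... | inj₂ (there πx∈xs) = πx∈xs

  countClasses-involution : ∀ L → Unique L → (∀ {y} → y ∈ L → π y ∈ L) →
                            2 * countClasses R R? P P? L ≡ count P? L
  countClasses-involution L L-uniq closed = begin
    2 * countClasses R R? P P? L                          ≡⟨ sym (+-identityʳ _) ⟩
    2 * countClasses R R? P P? L + 0                      ≡⟨ cong (2 * countClasses R R? P P? L +_) nothing-paired ⟩
    2 * countClasses R R? P P? L + count (Paired? []) L   ≡⟨ countClassesFrom-invariant [] L L-uniq (λ _ ()) (inj₂ ∘ closed) ⟩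
    count P? L                                            ∎
    where
    nothing-paired : 0 ≡ count (Paired? []) L
    nothing-paired = sym (count-none (Paired? []) (All.universal (λ _ ()) L))

open import Data.List.Membership.Propositional using () renaming (_∈_ to _∈ₗ_)
open import Data.Vec using (Vec; []; _∷_; here; there)
import Data.Vec as Vec
open import Data.Vec.Properties using (∷-injectiveʳ; lookup∘tabulate; []=⇒lookup)
open import Data.Vec.Relation.Binary.Pointwise.Inductive
  using (Pointwise-≡⇒≡; zipWith-assoc; zipWith-comm; zipWith-identityˡ; zipWith-identityʳ)
open import Data.Fin.Subset using (Subset; ⊥; ⊤; ⁅_⁆; _∪_; _∈_; _∉_; _⊆_; ∣_∣)
open import Data.Fin.Subset.Properties
  using (_∈?_; ∉⊥; ∣⊥∣≡0; ⊆⊤; ∣⊤∣≡n; s⊆s; x∈⁅x⁆; x∈⁅y⁆⇒x≡y; ∣⁅x⁆∣≡1; x∈p∪q⁺; p⊆q⇒∣p∣≤∣q∣)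

-- F₂^r and its subsets

⊕-self : ∀ {r} (x : F2^ r) → x ⊕ x ≡ 𝟎
⊕-self []      = refl
⊕-self (b ∷ x) = cong₂ _∷_ (xor-same b) (⊕-self x)

⊕-isAbelianGroup : ∀ r → IsAbelianGroup _≡_ (_⊕_ {r}) 𝟎 id
⊕-isAbelianGroup r = record
  { isGroup = record
    { isMonoid = record
      { isSemigroup = record
        { isMagma = record { isEquivalence = isEquivalence ; ∙-cong = cong₂ _⊕_ }
        ; assoc   = λ x y z → Pointwise-≡⇒≡ (zipWith-assoc xor-assoc x y z)
        }
      ; identity = (λ x → Pointwise-≡⇒≡ (zipWith-identityˡ xor-identityˡ x))
                 , (λ x → Pointwise-≡⇒≡ (zipWith-identityʳ xor-identityʳ x))
      }
    ; inverse = ⊕-self , ⊕-self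
    ; ⁻¹-cong = cong id
    }
  ; comm = λ x y → Pointwise-≡⇒≡ (zipWith-comm xor-comm x y)
  }

⊕-abelianGroup : ℕ → AbelianGroup 0ℓ 0ℓ
⊕-abelianGroup r = record { isAbelianGroup = ⊕-isAbelianGroup r }

module _ {r : ℕ} where
  open AbelianGroup (⊕-abelianGroup r) public
    using () renaming (assoc to ⊕-assoc; identityˡ to ⊕-identityˡ; identityʳ to ⊕-identityʳ)
  open import Algebra.Properties.AbelianGroup (⊕-abelianGroup r) public
    using () renaming (∙-cancelˡ to ⊕-cancelˡ; x∙y⁻¹≈ε⇒x≈y to ⊕≡𝟎⇒≡)
  open import Algebra.Properties.CommutativeSemigroup
    (AbelianGroup.commutativeSemigroup (⊕-abelianGroup r)) public
    using () renaming (interchange to ⊕-interchange; x∙yz≈y∙xz to ⊕-leftComm)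

module _ {r : ℕ} where

  subsetSum-⊥ : ∀ {n} (s : Fin n → F2^ r) → subsetSum s ⊥ ≡ 𝟎
  subsetSum-⊥ {zero}  s = refl
  subsetSum-⊥ {suc n} s = subsetSum-⊥ (λ i → s (fs i))

  subsetSum-⁅⁆ : ∀ {n} (s : Fin n → F2^ r) (g : Fin n) → subsetSum s ⁅ g ⁆ ≡ s g
  subsetSum-⁅⁆ s fz     = trans (cong (s fz ⊕_) (subsetSum-⊥ (λ i → s (fs i)))) (⊕-identityʳ (s fz))
  subsetSum-⁅⁆ s (fs g) = subsetSum-⁅⁆ (λ i → s (fs i)) g

  subsetSum-⊕ : ∀ {n} (s : Fin n → F2^ r) (U V : Subset n) →
                subsetSum s (U ⊕ V) ≡ subsetSum s U ⊕ subsetSum s V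
  subsetSum-⊕ s []          []          = sym (⊕-identityʳ 𝟎)
  subsetSum-⊕ s (false ∷ U) (false ∷ V) = subsetSum-⊕ (λ i → s (fs i)) U V
  subsetSum-⊕ s (false ∷ U) (true ∷ V)  =
    trans (cong (s fz ⊕_) (subsetSum-⊕ (λ i → s (fs i)) U V)) (⊕-leftComm (s fz) _ _)
  subsetSum-⊕ s (true ∷ U)  (false ∷ V) =
    trans (cong (s fz ⊕_) (subsetSum-⊕ (λ i → s (fs i)) U V)) (sym (⊕-assoc (s fz) _ _))
  subsetSum-⊕ s (true ∷ U)  (true ∷ V)  = begin
    subsetSum s′ (U ⊕ V)               ≡⟨ subsetSum-⊕ s′ U V ⟩
    subsetSum s′ U ⊕ subsetSum s′ V     ≡⟨ sym (⊕-identityˡ _) ⟩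
    𝟎 ⊕ (subsetSum s′ U ⊕ subsetSum s′ V)  ≡⟨ cong (_⊕ (subsetSum s′ U ⊕ subsetSum s′ V)) (sym (⊕-self (s fz))) ⟩
    (s fz ⊕ s fz) ⊕ (subsetSum s′ U ⊕ subsetSum s′ V) ≡⟨ ⊕-interchange (s fz) (s fz) _ _ ⟩
    (s fz ⊕ subsetSum s′ U) ⊕ (s fz ⊕ subsetSum s′ V) ∎
    where
    open ≡-Reasoning
    s′ = λ i → s (fs i)

-- On subsets, _⊕_ is symmetric difference.
x∈p⊕q⁻ : ∀ {n} {x : Fin n} (p q : Subset n) → x ∈ p ⊕ q → x ∈ p ⊎ x ∈ q
x∈p⊕q⁻ (true ∷ p)  (false ∷ q) here          = inj₁ here
x∈p⊕q⁻ (false ∷ p) (true ∷ q)  here          = inj₂ here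
x∈p⊕q⁻ (_ ∷ p)     (_ ∷ q)     (there x∈p⊕q) = Sum.map there there (x∈p⊕q⁻ p q x∈p⊕q)

x∈p∧x∉q⇒x∈p⊕q : ∀ {n} {x : Fin n} {p q : Subset n} → x ∈ p → x ∉ q → x ∈ p ⊕ q
x∈p∧x∉q⇒x∈p⊕q {p = _ ∷ _} {false ∷ q} here       x∉q = here
x∈p∧x∉q⇒x∈p⊕q {p = _ ∷ _} {true ∷ q}  here       x∉q = contradiction here x∉q
x∈p∧x∉q⇒x∈p⊕q {p = _ ∷ _} {_ ∷ q}     (there x∈p) x∉q = there (x∈p∧x∉q⇒x∈p⊕q x∈p (λ x∈q → x∉q (there x∈q)))

∣p∪q∣≤∣p∣+∣q∣ : ∀ {n} (p q : Subset n) → ∣ p ∪ q ∣ ≤ ∣ p ∣ + ∣ q ∣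
∣p∪q∣≤∣p∣+∣q∣ []          []          = z≤n
∣p∪q∣≤∣p∣+∣q∣ (false ∷ p) (false ∷ q) = ∣p∪q∣≤∣p∣+∣q∣ p q
∣p∪q∣≤∣p∣+∣q∣ (false ∷ p) (true ∷ q)  =
  subst (suc ∣ p ∪ q ∣ ≤_) (sym (+-suc ∣ p ∣ ∣ q ∣)) (s≤s (∣p∪q∣≤∣p∣+∣q∣ p q))
∣p∪q∣≤∣p∣+∣q∣ (true ∷ p)  (false ∷ q) = s≤s (∣p∪q∣≤∣p∣+∣q∣ p q)
∣p∪q∣≤∣p∣+∣q∣ (true ∷ p)  (true ∷ q)  =
  s≤s (≤-trans (∣p∪q∣≤∣p∣+∣q∣ p q) (subst (∣ p ∣ + ∣ q ∣ ≤_) (sym (+-suc ∣ p ∣ ∣ q ∣)) (n≤1+n _)))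

∣⁅x⁆∪p∣≤1+∣p∣ : ∀ {n} (x : Fin n) (p : Subset n) → ∣ ⁅ x ⁆ ∪ p ∣ ≤ suc ∣ p ∣
∣⁅x⁆∪p∣≤1+∣p∣ x p = subst (λ k → ∣ ⁅ x ⁆ ∪ p ∣ ≤ k + ∣ p ∣) (∣⁅x⁆∣≡1 x) (∣p∪q∣≤∣p∣+∣q∣ ⁅ x ⁆ p)

∣p⊕q∣≤∣p∣+∣q∣ : ∀ {n} (p q : Subset n) → ∣ p ⊕ q ∣ ≤ ∣ p ∣ + ∣ q ∣
∣p⊕q∣≤∣p∣+∣q∣ p q = ≤-trans (p⊆q⇒∣p∣≤∣q∣ (λ x∈p⊕q → x∈p∪q⁺ (x∈p⊕q⁻ p q x∈p⊕q))) (∣p∪q∣≤∣p∣+∣q∣ p q)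

∣q∣<∣p∣⇒∃∈p∉q : ∀ {n} (p q : Subset n) → ∣ q ∣ < ∣ p ∣ → ∃ λ x → x ∈ p × x ∉ q
∣q∣<∣p∣⇒∃∈p∉q {n} p q ∣q∣<∣p∣ = witness (Finₚ.¬∀⟶∃¬ n _ (λ x → x ∈? p →-dec x ∈? q) p⊈q)
  where
  p⊈q : ¬ (∀ x → x ∈ p → x ∈ q)
  p⊈q p⊆q = <⇒≱ ∣q∣<∣p∣ (p⊆q⇒∣p∣≤∣q∣ (p⊆q _))
  witness : (∃ λ x → ¬ (x ∈ p → x ∈ q)) → ∃ λ x → x ∈ p × x ∉ q
  witness (x , x∈p⇏x∈q) with x ∈? p
  ... | yes x∈p = x , x∈p , λ x∈q → x∈p⇏x∈q (λ _ → x∈q)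
  ... | no  x∉p = contradiction (λ x∈p → contradiction x∈p x∉p) x∈p⇏x∈q

superset-of-size : ∀ {n} m (W : Subset n) → ∣ W ∣ ≤ m → m ≤ n → ∃ λ T → W ⊆ T × ∣ T ∣ ≡ m
superset-of-size {zero}  zero    []          _       _       = [] , id , refl
superset-of-size {suc n} zero    (false ∷ W) ∣W∣≤0   _       =
  let T , W⊆T , ∣T∣≡0 = superset-of-size zero W ∣W∣≤0 z≤n in false ∷ T , s⊆s W⊆T , ∣T∣≡0
superset-of-size {suc n} (suc m) (true ∷ W)  (s≤s ∣W∣≤m) (s≤s m≤n) =
  let T , W⊆T , ∣T∣≡m = superset-of-size m W ∣W∣≤m m≤n in true ∷ T , s⊆s W⊆T , cong suc ∣T∣≡m
superset-of-size {suc n} (suc m) (false ∷ W) ∣W∣≤1+m 1+m≤1+n with suc m ≤? n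
... | yes 1+m≤n =
  let T , W⊆T , ∣T∣≡1+m = superset-of-size (suc m) W ∣W∣≤1+m 1+m≤n in false ∷ T , s⊆s W⊆T , ∣T∣≡1+m
... | no  1+m≰n = ⊤ , ⊆⊤ , trans (∣⊤∣≡n (suc n)) (≤-antisym (≰⇒> 1+m≰n) 1+m≤1+n)

module _ {r n m : ℕ} {s : Fin n → F2^ r} (indep : AnyLinIndep m s) (m≤n : m ≤ n) where

  anyLinIndep-≤ : ∀ W → ∣ W ∣ ≤ m → subsetSum s W ≡ 𝟎 → W ≡ ⊥
  anyLinIndep-≤ W ∣W∣≤m ΣW≡𝟎 =
    let T , W⊆T , ∣T∣≡m = superset-of-size m W ∣W∣≤m m≤n in indep T ∣T∣≡m W W⊆T ΣW≡𝟎

  anyLinIndep⇒≢𝟎 : 1 ≤ m → ∀ g → s g ≢ 𝟎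
  anyLinIndep⇒≢𝟎 1≤m g sg≡𝟎 = ∉⊥ (subst (g ∈_) ⁅g⁆≡⊥ (x∈⁅x⁆ g))
    where
    ⁅g⁆≡⊥ : ⁅ g ⁆ ≡ ⊥
    ⁅g⁆≡⊥ = anyLinIndep-≤ ⁅ g ⁆ (subst (_≤ m) (sym (∣⁅x⁆∣≡1 g)) 1≤m) (trans (subsetSum-⁅⁆ s g) sg≡𝟎)

∈-tabulate-does : ∀ {n p} {P : Fin n → Set p} (P? : ∀ i → Dec (P i)) {i} → i ∈ Vec.tabulate (does ∘ P?) → P i
∈-tabulate-does P? {i} i∈ with P? i | trans (sym (lookup∘tabulate (does ∘ P?) i)) ([]=⇒lookup i∈)
... | yes Pi | _ = Pi
... | no  _  | ()

∣tabulate-not∣+∣tabulate∣≡n : ∀ {n} (f : Fin n → Bool) → ∣ Vec.tabulate (not ∘ f) ∣ + ∣ Vec.tabulate f ∣ ≡ n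
∣tabulate-not∣+∣tabulate∣≡n {zero}  f = refl
∣tabulate-not∣+∣tabulate∣≡n {suc n} f with f fz
... | true  = trans (+-suc _ _) (cong suc (∣tabulate-not∣+∣tabulate∣≡n (f ∘ fs)))
... | false = cong suc (∣tabulate-not∣+∣tabulate∣≡n (f ∘ fs))

pick-distinct : ∀ {n} k (p : Subset n) → k ≤ ∣ p ∣ →
                ∃ λ (e : Fin k → Fin n) → Injective _≡_ _≡_ e × (∀ i → e i ∈ p)
pick-distinct zero    p           _ = (λ ()) , (λ { {()} }) , λ ()
pick-distinct (suc k) (true ∷ p)  (s≤s k≤∣p∣) =
  let e , e-inj , e∈p = pick-distinct k p k≤∣p∣ in
  (λ { fz → fz ; (fs i) → fs (e i) }) ,
  (λ { {fz} {fz} _ → refl ; {fs i} {fs j} eq → cong fs (e-inj (Finₚ.suc-injective eq)) }) ,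
  (λ { fz → here ; (fs i) → there (e∈p i) })
pick-distinct (suc k) (false ∷ p) k≤∣p∣ =
  let e , e-inj , e∈p = pick-distinct (suc k) p k≤∣p∣ in
  fs ∘ e , e-inj ∘ Finₚ.suc-injective , λ i → there (e∈p i)

-- Reed–Solomon codes

module ReedSolomon {c ℓ} (F : FiniteField c ℓ) where
  open FiniteField F using (Carrier; _≈_; 0#; _≟_) renaming (sym to ≈-sym; trans to ≈-trans)
  open RSCode F

  zeros : ∀ {n} → (Fin n → Carrier) → Subset n
  zeros w = Vec.tabulate (λ i → does (w i ≟ 0#))

  support : ∀ {n} → (Fin n → Carrier) → Subset n
  support w = Vec.tabulate (λ i → does (¬? (w i ≟ 0#)))

  ∣zeros∣<k : ∀ {n k xs w} → Injective _≡_ _≈_ xs → InRS n k xs w → ∀ i → ¬ (w i ≈ 0#) → ∣ zeros w ∣ < k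
  ∣zeros∣<k {n} {k} {xs} {w} xs-inj (cs , w≈) i wi≉0 with k ≤? ∣ zeros w ∣
  ... | no  k≰∣zeros∣ = ≰⇒> k≰∣zeros∣
  ... | yes k≤∣zeros∣ = contradiction (≈-trans (w≈ i) (p≈0 (xs i))) wi≉0
    where
    picked = pick-distinct k (zeros w) k≤∣zeros∣
    e = proj₁ picked
    p≈0 : ∀ x → evalPoly k cs x ≈ 0#
    p≈0 = degreeBelow-vanishes F k (evalPoly k cs) (evalPoly-degreeBelow F k cs) (xs ∘ e)
            (proj₁ (proj₂ picked) ∘ xs-inj)
            (λ j → ≈-trans (≈-sym (w≈ (e j))) (∈-tabulate-does (λ j → w j ≟ 0#) (proj₂ (proj₂ picked) j)))

  rs-weight : ∀ {n k xs w} → k ≤ n → Injective _≡_ _≈_ xs → InRS n k xs w → ∀ i → ¬ (w i ≈ 0#) →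
              n ∸ k + 1 ≤ ∣ support w ∣
  rs-weight {n} {k} {w = w} k≤n xs-inj w∈RS i wi≉0 = +-cancelʳ-≤ k _ _ (begin
    n ∸ k + 1 + k                ≡⟨ +-assoc (n ∸ k) 1 k ⟩
    n ∸ k + suc k                ≡⟨ +-suc (n ∸ k) k ⟩
    suc (n ∸ k + k)              ≡⟨ cong suc (m∸n+n≡m k≤n) ⟩
    suc n                        ≡⟨ cong suc (sym (∣tabulate-not∣+∣tabulate∣≡n (λ i → does (w i ≟ 0#)))) ⟩
    suc (∣ support w ∣ + ∣ zeros w ∣) ≡⟨ sym (+-suc _ _) ⟩
    ∣ support w ∣ + suc ∣ zeros w ∣   ≤⟨ +-monoʳ-≤ ∣ support w ∣ (∣zeros∣<k xs-inj w∈RS i wi≉0) ⟩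
    ∣ support w ∣ + k                ∎)
    where open ≤-Reasoning

-- Exploring the Cayley graph

-- the number of subsets of size at most j of an a-element set
ballSize : ℕ → ℕ → ℕ
ballSize zero    _       = 1
ballSize (suc a) zero    = 1
ballSize (suc a) (suc j) = ballSize a (suc j) + ballSize a j

2^≤ballSize : ∀ a l → a ≤ l → 2 ^ a ≤ ballSize a l
2^≤ballSize zero    l       _         = ≤-refl
2^≤ballSize (suc a) (suc l) (s≤s a≤l) =
  subst (_≤ ballSize a (suc l) + ballSize a l) (cong (2 ^ a +_) (sym (+-identityʳ (2 ^ a))))
    (+-mono-≤ (2^≤ballSize a (suc l) (m≤n⇒m≤1+n a≤l)) (2^≤ballSize a l a≤l))

2^≤1+ballSize : ∀ a l → a ≤ l → 2 ^ suc a ≤ suc (ballSize (suc a) l)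
2^≤1+ballSize zero    zero    _         = s≤s (s≤s z≤n)
2^≤1+ballSize zero    (suc l) _         = s≤s (s≤s z≤n)
2^≤1+ballSize (suc a) (suc l) (s≤s a≤l) =
  subst (_≤ suc (ballSize (suc a) (suc l) + ballSize (suc a) l)) (cong (2 ^ suc a +_) (sym (+-identityʳ (2 ^ suc a))))
    (subst (2 ^ suc a + 2 ^ suc a ≤_) (+-suc _ _)
      (+-mono-≤ (2^≤ballSize (suc a) (suc l) (s≤s a≤l)) (2^≤1+ballSize a l a≤l)))

2^≤ballSize+ballSize : ∀ a j l → a ≤ suc (j + l) → 2 ^ a ≤ ballSize a j + ballSize a l
2^≤ballSize+ballSize zero    j       l       _ = s≤s z≤n
2^≤ballSize+ballSize (suc a) zero    l       (s≤s a≤l) = 2^≤1+ballSize a l a≤l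
2^≤ballSize+ballSize (suc a) (suc j) zero    (s≤s a≤1+j) =
  subst (2 ^ suc a ≤_) (+-comm 1 (ballSize (suc a) (suc j)))
    (2^≤1+ballSize a (suc j) (subst (a ≤_) (+-identityʳ (suc j)) a≤1+j))
2^≤ballSize+ballSize (suc a) (suc j) (suc l) (s≤s a≤2+j+l) = begin
  2 ^ suc a                                 ≡⟨ cong (2 ^ a +_) (+-identityʳ (2 ^ a)) ⟩
  2 ^ a + 2 ^ a                             ≤⟨ +-mono-≤ (2^≤ballSize+ballSize a (suc j) l a≤2+j+l′)
                                                        (2^≤ballSize+ballSize a j (suc l) a≤2+j+l) ⟩
  (b₁ j + b₀ l) + (b₀ j + b₁ l)             ≡⟨ rearrange (b₁ j) (b₀ l) (b₀ j) (b₁ l) ⟩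
  (b₁ j + b₀ j) + (b₁ l + b₀ l)             ∎
  where
  open ≤-Reasoning
  b₀ b₁ : ℕ → ℕ
  b₀ = ballSize a
  b₁ = ballSize a ∘ suc
  a≤2+j+l′ : a ≤ suc (suc j + l)
  a≤2+j+l′ = subst (a ≤_) (cong suc (+-suc j l)) a≤2+j+l
  rearrange : ∀ w x y z → (w + x) + (y + z) ≡ (w + y) + (z + x)
  rearrange = solve-∀

Unique-map⁺-on : ∀ {a b p} {A : Set a} {B : Set b} {P : A → Set p} (f : A → B) {xs} → All P xs →
                 (∀ {x y} → P x → P y → f x ≡ f y → x ≡ y) → Unique xs → Unique (map f xs)
Unique-map⁺-on f []         f-inj []                = []
Unique-map⁺-on f (Px ∷ Pxs) f-inj (x≢xs ∷ xs-unique) =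
  All.map⁺ (All.zipWith (λ (Py , x≢y) fx≡fy → x≢y (f-inj Px Py fx≡fy)) (Pxs , x≢xs)) ∷
  Unique-map⁺-on f Pxs f-inj xs-unique

module Exploration {ℓ r n m} (s : Fin n → F2^ r) (Live : F2^ r → Set ℓ) (dirs : F2^ r → Subset n)
  (dirs-large : ∀ {x} → Live x → m ≤ ∣ dirs x ∣) (dirs-live : ∀ {x g} → g ∈ dirs x → Live (x ⊕ s g)) where

  Reach : Subset n → ℕ → F2^ r → Subset n → Set ℓ
  Reach B j x U = ∣ U ∣ ≤ j × (∀ {i} → i ∈ U → i ∉ B) × Live (x ⊕ subsetSum s U)

  reach-⊥ : ∀ {B j x} → Live x → Reach B j x ⊥
  reach-⊥ {B} {j} {x} live = subst (_≤ j) (sym (∣⊥∣≡0 n)) z≤n , (λ i∈⊥ → contradiction i∈⊥ ∉⊥) ,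
    subst Live (sym (trans (cong (x ⊕_) (subsetSum-⊥ s)) (⊕-identityʳ x))) live

  reach-avoid : ∀ {g B j x U} → Reach (⁅ g ⁆ ∪ B) j x U → Reach B j x U
  reach-avoid {g} (∣U∣≤j , U∩B′≡∅ , live) = ∣U∣≤j , (λ i∈U i∈B → U∩B′≡∅ i∈U (x∈p∪q⁺ (inj₂ i∈B))) , live

  reach-step : ∀ {g B j x U} → g ∉ B → Reach (⁅ g ⁆ ∪ B) j (x ⊕ s g) U → Reach B (suc j) x (⁅ g ⁆ ⊕ U)
  reach-step {g} {B} {j} {x} {U} g∉B (∣U∣≤j , U∩B′≡∅ , live) = ∣gU∣≤1+j , gU∩B≡∅ , subst Live vertex≡ live
    where
    ∣gU∣≤1+j : ∣ ⁅ g ⁆ ⊕ U ∣ ≤ suc j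
    ∣gU∣≤1+j = ≤-trans (∣p⊕q∣≤∣p∣+∣q∣ ⁅ g ⁆ U) (subst (λ k → k + ∣ U ∣ ≤ suc j) (sym (∣⁅x⁆∣≡1 g)) (s≤s ∣U∣≤j))
    gU∩B≡∅ : ∀ {i} → i ∈ ⁅ g ⁆ ⊕ U → i ∉ B
    gU∩B≡∅ i∈gU with x∈p⊕q⁻ ⁅ g ⁆ U i∈gU
    ... | inj₁ i∈⁅g⁆ = subst (_∉ B) (sym (x∈⁅y⁆⇒x≡y g i∈⁅g⁆)) g∉B
    ... | inj₂ i∈U   = λ i∈B → U∩B′≡∅ i∈U (x∈p∪q⁺ (inj₂ i∈B))
    vertex≡ : (x ⊕ s g) ⊕ subsetSum s U ≡ x ⊕ subsetSum s (⁅ g ⁆ ⊕ U)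
    vertex≡ = begin
      (x ⊕ s g) ⊕ subsetSum s U                  ≡⟨ ⊕-assoc x (s g) _ ⟩
      x ⊕ (s g ⊕ subsetSum s U)                  ≡⟨ cong (λ v → x ⊕ (v ⊕ subsetSum s U)) (sym (subsetSum-⁅⁆ s g)) ⟩
      x ⊕ (subsetSum s ⁅ g ⁆ ⊕ subsetSum s U)    ≡⟨ cong (x ⊕_) (sym (subsetSum-⊕ s ⁅ g ⁆ U)) ⟩
      x ⊕ subsetSum s (⁅ g ⁆ ⊕ U)                ∎
      where open ≡-Reasoning

  private
    room : ∀ {b a x} → Live x → b + suc a ≤ m → b < ∣ dirs x ∣
    room {b} {a} live b+1+a≤m =
      ≤-trans (s≤s (m≤m+n b a)) (≤-trans (≤-reflexive (sym (+-suc b a))) (≤-trans b+1+a≤m (dirs-large live)))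

  branch : ∀ {g B j x Us₁ Us₂} → g ∉ B →
           Unique Us₁ → All (Reach (⁅ g ⁆ ∪ B) (suc j) x) Us₁ →
           Unique Us₂ → All (Reach (⁅ g ⁆ ∪ B) j (x ⊕ s g)) Us₂ →
           Unique (Us₁ ++ map (⁅ g ⁆ ⊕_) Us₂) × All (Reach B (suc j) x) (Us₁ ++ map (⁅ g ⁆ ⊕_) Us₂)
  branch {g} {Us₁ = Us₁} {Us₂} g∉B Us₁-unique Us₁-reach Us₂-unique Us₂-reach =
    Unique.++⁺ Us₁-unique (Unique.map⁺ (⊕-cancelˡ ⁅ g ⁆ _ _) Us₂-unique)
               (λ (U∈Us₁ , U∈gUs₂) → g∉Us₁ U∈Us₁ (g∈gUs₂ U∈gUs₂)) ,
    All.++⁺ (All.map reach-avoid Us₁-reach) (All.map⁺ (All.map (reach-step g∉B) Us₂-reach))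
    where
    g∈B′ : g ∈ ⁅ g ⁆ ∪ _
    g∈B′ = x∈p∪q⁺ (inj₁ (x∈⁅x⁆ g))
    g∉Us₁ : ∀ {U} → U ∈ₗ Us₁ → g ∉ U
    g∉Us₁ U∈Us₁ g∈U = proj₁ (proj₂ (All.lookup Us₁-reach U∈Us₁)) g∈U g∈B′
    g∈gUs₂ : ∀ {U} → U ∈ₗ map (⁅ g ⁆ ⊕_) Us₂ → g ∈ U
    g∈gUs₂ U∈gUs₂ with ∈-map⁻ (⁅ g ⁆ ⊕_) U∈gUs₂
    ... | U′ , U′∈Us₂ , refl = x∈p∧x∉q⇒x∈p⊕q (x∈⁅x⁆ g) (λ g∈U′ → proj₁ (proj₂ (All.lookup Us₂-reach U′∈Us₂)) g∈U′ g∈B′)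

  explore : ∀ a j x → Live x → ∀ B → ∣ B ∣ + a ≤ m →
            ∃ λ Us → Unique Us × All (Reach B j x) Us × length Us ≡ ballSize a j
  explore zero    j       x live B _ = ⊥ ∷ [] , [] ∷ [] , reach-⊥ live ∷ [] , refl
  explore (suc a) zero    x live B _ = ⊥ ∷ [] , [] ∷ [] , reach-⊥ live ∷ [] , refl
  explore (suc a) (suc j) x live B ∣B∣+1+a≤m =
    let g , g∈dirs , g∉B = ∣q∣<∣p∣⇒∃∈p∉q (dirs x) B (room live ∣B∣+1+a≤m)
        ∣B′∣+a≤m = ≤-trans (+-monoˡ-≤ a (∣⁅x⁆∪p∣≤1+∣p∣ g B)) (subst (_≤ m) (+-suc ∣ B ∣ a) ∣B∣+1+a≤m)
        Us₁ , Us₁-unique , Us₁-reach , Us₁-length = explore a (suc j) x live (⁅ g ⁆ ∪ B) ∣B′∣+a≤m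
        Us₂ , Us₂-unique , Us₂-reach , Us₂-length = explore a j (x ⊕ s g) (dirs-live g∈dirs) (⁅ g ⁆ ∪ B) ∣B′∣+a≤m
        Us-unique , Us-reach = branch g∉B Us₁-unique Us₁-reach Us₂-unique Us₂-reach
    in Us₁ ++ map (⁅ g ⁆ ⊕_) Us₂ , Us-unique , Us-reach ,
       trans (length-++ Us₁) (cong₂ _+_ Us₁-length (trans (length-map _ Us₂) Us₂-length))

  live-vertices : (∀ W → ∣ W ∣ ≤ m → subsetSum s W ≡ 𝟎 → W ≡ ⊥) → ∀ {x₀} → Live x₀ →
                  ∃ λ D → Unique D × All Live D × 2 ^ m ≤ 2 * length D
  live-vertices indep {x₀} live =
    let Us , Us-unique , Us-reach , Us-length = explore m j x₀ live ⊥ (subst (λ b → b + m ≤ m) (sym (∣⊥∣≡0 n)) ≤-refl)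
    in map vertex Us ,
       Unique-map⁺-on vertex Us-reach vertex-injective Us-unique ,
       All.map⁺ (All.map (proj₂ ∘ proj₂) Us-reach) ,
       subst (λ L → 2 ^ m ≤ 2 * L) (sym (trans (length-map vertex Us) Us-length))
         (≤-trans (2^≤ballSize+ballSize m j j m≤1+j+j) (≤-reflexive (cong (ballSize m j +_) (sym (+-identityʳ _)))))
    where
    j = ⌊ m /2⌋
    j+j≤m : j + j ≤ m
    j+j≤m = begin
      j + j          ≤⟨ +-monoʳ-≤ j (⌊n/2⌋≤⌈n/2⌉ m) ⟩
      j + ⌈ m /2⌉    ≡⟨ ⌊n/2⌋+⌈n/2⌉≡n m ⟩
      m              ∎
      where open ≤-Reasoning
    m≤1+j+j : m ≤ suc (j + j)
    m≤1+j+j = begin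
      m              ≡⟨ sym (⌊n/2⌋+⌈n/2⌉≡n m) ⟩
      j + ⌈ m /2⌉    ≤⟨ +-monoʳ-≤ j (⌊n/2⌋-mono (n≤1+n (suc m))) ⟩
      j + suc j      ≡⟨ +-suc j j ⟩
      suc (j + j)    ∎
      where open ≤-Reasoning
    vertex : Subset n → F2^ r
    vertex U = x₀ ⊕ subsetSum s U
    vertex-injective : ∀ {U U′} → Reach ⊥ j x₀ U → Reach ⊥ j x₀ U′ → vertex U ≡ vertex U′ → U ≡ U′
    vertex-injective {U} {U′} (∣U∣≤j , _) (∣U′∣≤j , _) eq =
      ⊕≡𝟎⇒≡ U U′ (indep (U ⊕ U′) (≤-trans (∣p⊕q∣≤∣p∣+∣q∣ U U′) (≤-trans (+-mono-≤ ∣U∣≤j ∣U′∣≤j) j+j≤m)) (begin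
        subsetSum s (U ⊕ U′)                ≡⟨ subsetSum-⊕ s U U′ ⟩
        subsetSum s U ⊕ subsetSum s U′      ≡⟨ cong (_⊕ subsetSum s U′) (⊕-cancelˡ x₀ _ _ eq) ⟩
        subsetSum s U′ ⊕ subsetSum s U′     ≡⟨ ⊕-self (subsetSum s U′) ⟩
        𝟎                                   ∎))
      where open ≡-Reasoning

-- Counting half-edges

∈-allVecs : ∀ r (v : F2^ r) → v ∈ₗ allVecs r
∈-allVecs zero    Vec.[]            = here refl
∈-allVecs (suc r) (false Vec.∷ v) = ∈-++⁺ˡ (∈-map⁺ (false Vec.∷_) (∈-allVecs r v))
∈-allVecs (suc r) (true Vec.∷ v)  = ∈-++⁺ʳ _ (∈-map⁺ (true Vec.∷_) (∈-allVecs r v))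

allVecs-unique : ∀ r → Unique (allVecs r)
allVecs-unique zero    = [] ∷ []
allVecs-unique (suc r) =
  Unique.++⁺ (Unique.map⁺ ∷-injectiveʳ (allVecs-unique r)) (Unique.map⁺ ∷-injectiveʳ (allVecs-unique r)) heads-differ
  where
  heads-differ : ∀ {v} → ¬ (v ∈ₗ map (false Vec.∷_) (allVecs r) × v ∈ₗ map (true Vec.∷_) (allVecs r))
  heads-differ (v∈₀ , v∈₁) with ∈-map⁻ (false Vec.∷_) v∈₀ | ∈-map⁻ (true Vec.∷_) v∈₁
  ... | _ , _ , refl | _ , _ , ()

length-allVecs : ∀ r → length (allVecs r) ≡ 2 ^ r
length-allVecs zero    = refl
length-allVecs (suc r) = trans (length-++ (map (false Vec.∷_) (allVecs r)))
  (cong₂ _+_ (trans (length-map _ (allVecs r)) (length-allVecs r))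
             (trans (trans (length-map _ (allVecs r)) (length-allVecs r)) (sym (+-identityʳ _))))

length-cartesianProduct : ∀ {a b} {A : Set a} {B : Set b} (xs : List A) (ys : List B) →
                          length (cartesianProduct xs ys) ≡ length xs * length ys
length-cartesianProduct []       ys = refl
length-cartesianProduct (x ∷ xs) ys =
  trans (length-++ (map (x ,_) ys)) (cong₂ _+_ (length-map _ ys) (length-cartesianProduct xs ys))

count-tabulate : ∀ {a p} {A : Set a} {P : A → Set p} (P? : ∀ x → Dec (P x)) {n} (h : Fin n → A) →
                 count P? (tabulate h) ≡ ∣ Vec.tabulate (does ∘ P? ∘ h) ∣
count-tabulate P? {zero}  h = refl
count-tabulate P? {suc n} h with P? (h fz)
... | yes _ = cong suc (count-tabulate P? (h ∘ fs))
... | no  _ = count-tabulate P? (h ∘ fs)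

module HalfEdges {r n : ℕ} (s : Fin n → F2^ r) (s≢𝟎 : ∀ g → s g ≢ 𝟎) where
  open Cayley s

  partner : F2^ r × Fin n → F2^ r × Fin n
  partner (v , ℓ) = E v ℓ , ℓ

  E-E : ∀ v ℓ → E (E v ℓ) ℓ ≡ v
  E-E v ℓ = trans (⊕-assoc v (s ℓ) (s ℓ)) (trans (cong (v ⊕_) (⊕-self (s ℓ))) (⊕-identityʳ v))

  partner-involutive : ∀ x → partner (partner x) ≡ x
  partner-involutive (v , ℓ) = cong (_, ℓ) (E-E v ℓ)

  partner-fixpointFree : ∀ x → partner x ≢ x
  partner-fixpointFree (v , ℓ) eq = s≢𝟎 ℓ (⊕-cancelˡ v (s ℓ) 𝟎 (trans (cong proj₁ eq) (sym (⊕-identityʳ v))))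

  ∼E⇔ : ∀ {y x} → y ∼E x ⇔ (x ≡ y ⊎ partner x ≡ y)
  ∼E⇔ = mk⇔ to from
    where
    to : ∀ {y x} → y ∼E x → x ≡ y ⊎ partner x ≡ y
    to {v , ℓ} (refl , inj₁ refl) = inj₂ (cong (_, ℓ) (E-E v ℓ))
    to         (refl , inj₂ refl) = inj₁ refl
    from : ∀ {y x} → x ≡ y ⊎ partner x ≡ y → y ∼E x
    from            (inj₁ refl) = refl , inj₂ refl
    from {x = v , ℓ} (inj₂ refl) = refl , inj₁ (E-E v ℓ)

  allPairs-unique : Unique allPairs
  allPairs-unique = Unique.cartesianProduct⁺ (allVecs-unique r) (Unique.allFin⁺ n)

  ∈-allPairs : ∀ x → x ∈ₗ allPairs
  ∈-allPairs (v , ℓ) = ∈-cartesianProduct⁺ (∈-allVecs r v) (∈-allFin ℓ)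

  private
    _≟H_ : DecidableEquality (F2^ r × Fin n)
    _≟H_ = Product.≡-dec _≟V_ Fin._≟_

  module _ {c ℓ} (F : FiniteField c ℓ) where
    open FiniteField F using (Carrier; _≈_; 0#; _≟_) renaming (trans to ≈-trans)

    NonzeroAt : (F2^ r → Fin n → Carrier) → F2^ r × Fin n → Set ℓ
    NonzeroAt f (v , g) = ¬ (f v g ≈ 0#)

    nonzeroAt? : ∀ f → Decidable (NonzeroAt f)
    nonzeroAt? f (v , g) = ¬? (f v g ≟ 0#)

    numEdges-double : 2 * numEdges F ≡ 2 ^ r * n
    numEdges-double = begin
      2 * numEdges F                 ≡⟨ InvolutionClasses.countClasses-involution _≟H_ partner partner-involutive
                                           partner-fixpointFree ∼E? ∼E⇔ (λ _ → yes tt) (λ _ → tt)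
                                           allPairs allPairs-unique (λ {x} _ → ∈-allPairs (partner x)) ⟩
      count (λ _ → yes tt) allPairs  ≡⟨ count-all (λ _ → yes tt) (All.universal (λ _ → tt) allPairs) ⟩
      length allPairs                ≡⟨ length-cartesianProduct (allVecs r) (allFin n) ⟩
      length (allVecs r) * length (allFin n) ≡⟨ cong₂ _*_ (length-allVecs r) (length-tabulate id) ⟩
      2 ^ r * n                      ∎
      where open ≡-Reasoning

    weight-double : ∀ {f} → InW F f → 2 * weight F f ≡ count (nonzeroAt? f) allPairs
    weight-double {f} f∈W = InvolutionClasses.countClasses-involution _≟H_ partner partner-involutive
      partner-fixpointFree ∼E? ∼E⇔ (nonzeroAt? f) (λ {x} → nonzero-partner x)
      allPairs allPairs-unique (λ {x} _ → ∈-allPairs (partner x))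
      where
      nonzero-partner : ∀ x → NonzeroAt f x → NonzeroAt f (partner x)
      nonzero-partner (v , g) fvg≉0 fv′g≈0 = fvg≉0 (≈-trans (f∈W v g (E v g) (refl , inj₁ refl)) fv′g≈0)

density-bound : ∀ {m r n E W} → 2 * E ≡ 2 ^ r * n → m * 2 ^ m ≤ 2 * (2 * W) → m ≤ suc r →
                m * E ≤ W * n * 2 ^ (suc r ∸ m)
density-bound {m} {r} {n} {E} {W} 2E≡ m2^m≤4W m≤1+r = *-cancelˡ-≤ 4 (begin
  4 * (m * E)                   ≡⟨ shuffle₁ m E ⟩
  2 * m * (2 * E)               ≡⟨ cong (2 * m *_) 2E≡ ⟩
  2 * m * (2 ^ r * n)           ≡⟨ shuffle₂ m (2 ^ r) n ⟩
  m * n * (2 * 2 ^ r)           ≡⟨ cong (m * n *_) (sym 2^m*X≡2^[1+r]) ⟩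
  m * n * (2 ^ m * X)           ≡⟨ shuffle₃ m n (2 ^ m) X ⟩
  m * 2 ^ m * (n * X)           ≤⟨ *-monoˡ-≤ (n * X) m2^m≤4W ⟩
  2 * (2 * W) * (n * X)         ≡⟨ shuffle₄ W n X ⟩
  4 * (W * n * X)               ∎)
  where
  open ≤-Reasoning
  X = 2 ^ (suc r ∸ m)
  2^m*X≡2^[1+r] : 2 ^ m * X ≡ 2 * 2 ^ r
  2^m*X≡2^[1+r] = trans (sym (^-distribˡ-+-* 2 m (suc r ∸ m))) (cong (2 ^_) (m+[n∸m]≡n m≤1+r))
  shuffle₁ : ∀ m E → 4 * (m * E) ≡ 2 * m * (2 * E)
  shuffle₁ = solve-∀
  shuffle₂ : ∀ m P n → 2 * m * (P * n) ≡ m * n * (2 * P)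
  shuffle₂ = solve-∀
  shuffle₃ : ∀ m n Q X → m * n * (Q * X) ≡ m * Q * (n * X)
  shuffle₃ = solve-∀
  shuffle₄ : ∀ W n X → 2 * (2 * W) * (n * X) ≡ 4 * (W * n * X)
  shuffle₄ = solve-∀

module CodeWeight {r n : ℕ} (s : Fin n → F2^ r) (s≢𝟎 : ∀ g → s g ≢ 𝟎) {c ℓ} (F : FiniteField c ℓ) where
  open Cayley s
  open HalfEdges s s≢𝟎
  open FiniteField F using (Carrier; _≈_; 0#; _≟_) renaming (trans to ≈-trans)
  open ReedSolomon F

  RowNonzero : (F2^ r → Fin n → Carrier) → F2^ r → Set ℓ
  RowNonzero f v = ∃ λ g → ¬ (f v g ≈ 0#)

  count-row : ∀ f v → count (nonzeroAt? F f) (map (v ,_) (allFin n)) ≡ ∣ support (f v) ∣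
  count-row f v = trans (cong (count (nonzeroAt? F f)) (map-tabulate id (v ,_)))
                        (count-tabulate (nonzeroAt? F f) (v ,_))

  count-rows : ∀ {m} f → (∀ {v} → RowNonzero f v → m ≤ ∣ support (f v) ∣) → ∀ {D} → All (RowNonzero f) D →
               m * length D ≤ count (nonzeroAt? F f) (cartesianProduct D (allFin n))
  count-rows {m} f row-large {[]}    []             = ≤-reflexive (*-zeroʳ m)
  count-rows {m} f row-large {v ∷ D} (v-live ∷ D-live) = begin
    m * suc (length D)        ≡⟨ *-suc m (length D) ⟩
    m + m * length D          ≤⟨ +-mono-≤ (subst (m ≤_) (sym (count-row f v)) (row-large v-live))
                                           (count-rows f row-large D-live) ⟩
    count (nonzeroAt? F f) (map (v ,_) (allFin n)) + count (nonzeroAt? F f) (cartesianProduct D (allFin n))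
      ≡⟨ sym (count-++ (nonzeroAt? F f) (map (v ,_) (allFin n)) _) ⟩
    count (nonzeroAt? F f) (cartesianProduct (v ∷ D) (allFin n)) ∎
    where open ≤-Reasoning

  nonzero-half-edges : ∀ {k m xs f} → k ≤ n → Injective _≡_ _≈_ xs → n ∸ k + 1 ≡ m → m ≤ n → AnyLinIndep m s →
    InCode F k xs f → NonZero F f → m * 2 ^ m ≤ 2 * count (nonzeroAt? F f) allPairs
  nonzero-half-edges {k} {m} {xs} {f} k≤n xs-inj m≡ m≤n indep (f∈W , f∈RS) (v₀ , g₀ , fv₀g₀≉0) =
    let D , D-unique , D-live , 2^m≤2∣D∣ = Exploration.live-vertices s (RowNonzero f) (support ∘ f) row-large row-step
                                              (anyLinIndep-≤ indep m≤n) (g₀ , fv₀g₀≉0)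
    in begin
      m * 2 ^ m                   ≤⟨ *-monoʳ-≤ m 2^m≤2∣D∣ ⟩
      m * (2 * length D)          ≡⟨ x∙yz≈y∙xz m 2 (length D) ⟩
      2 * (m * length D)          ≤⟨ *-monoʳ-≤ 2 (count-rows f row-large D-live) ⟩
      2 * count (nonzeroAt? F f) (cartesianProduct D (allFin n))
        ≤⟨ *-monoʳ-≤ 2 (count-mono-⊆ (nonzeroAt? F f) (Unique.cartesianProduct⁺ D-unique (Unique.allFin⁺ n))
                                     (λ {x} _ → ∈-allPairs x)) ⟩
      2 * count (nonzeroAt? F f) allPairs ∎
    where
    open ≤-Reasoning
    row-large : ∀ {v} → RowNonzero f v → m ≤ ∣ support (f v) ∣
    row-large {v} (g , fvg≉0) = subst (_≤ ∣ support (f v) ∣) m≡ (rs-weight k≤n xs-inj (f∈RS v) g fvg≉0)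
    row-step : ∀ {v g} → g ∈ support (f v) → RowNonzero f (v ⊕ s g)
    row-step {v} {g} g∈support = g , λ fv′g≈0 →
      ∈-tabulate-does (λ i → ¬? (f v i ≟ 0#)) g∈support (≈-trans (f∈W v g (v ⊕ s g) (refl , inj₁ refl)) fv′g≈0)

mainTheorem6 : ∀ {c ℓ : Level} (F : FiniteField c ℓ) (n r d k : ℕ) →
    1 ≤ r → r ≤ n → 1 ≤ d → d ≤ r + 1 → k ≤ n → n ∸ k + 1 ≡ d ∸ 1 →
    (xs : Fin n → FiniteField.Carrier F) →
    Injective _≡_ (FiniteField._≈_ F) xs →
    (big : Fin (suc n) → FiniteField.Carrier F) →
    Injective _≡_ (FiniteField._≈_ F) big →
    (s : Fin n → F2^ r) →
    Injective _≡_ _≡_ s →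
    Spans s →
    AnyLinIndep (d ∸ 1) s →
    ∀ (f : F2^ r → Fin n → FiniteField.Carrier F) →
    Cayley.InCode s F k xs f →
    Cayley.NonZero s F f →
    (n ∸ k + 1) * Cayley.numEdges s F ≤ Cayley.weight s F f * n * 2 ^ (r + 2 ∸ d)
mainTheorem6 F n r (suc m) k _ r≤n (s≤s z≤n) 1+m≤r+1 k≤n m≡ xs xs-inj _ _ s _ _ indep f f∈C f≢0
  rewrite m≡ | +-comm r 2 =
  density-bound {W = Cayley.weight s F f} (HalfEdges.numEdges-double s s≢𝟎 F)
    (subst (m * 2 ^ m ≤_) (cong (2 *_) (sym (HalfEdges.weight-double s s≢𝟎 F (proj₁ f∈C))))
      (CodeWeight.nonzero-half-edges s s≢𝟎 F k≤n xs-inj m≡ m≤n indep f∈C f≢0))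
    m≤1+r
  where
  m≤r : m ≤ r
  m≤r = ≤-pred (subst (suc m ≤_) (+-comm r 1) 1+m≤r+1)
  m≤1+r : m ≤ suc r
  m≤1+r = m≤n⇒m≤1+n m≤r
  m≤n : m ≤ n
  m≤n = ≤-trans m≤r r≤n
  s≢𝟎 : ∀ g → s g ≢ 𝟎
  s≢𝟎 = anyLinIndep⇒≢𝟎 indep m≤n (subst (1 ≤_) m≡ (m≤n+m 1 (n ∸ k)))
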